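{- Let $k \geq 6$ and $\frac{k}{2} \leq m \leq k-2$. Then $g_1(k,m) \leq \binom{k}{m} - m$; that is, every finite $k$-uniform hypergraph $H$ with $\nu^{(m)}(H) = 1$ satisfies $\tau^{(m)}(H) \leq \binom{k}{m} - m$.
   Context: For a $k$-uniform hypergraph $H$ with vertex set $V$ and $1 \le m \le k-1$: an $m$-matching of $H$ is a set $M$ of edges with $|e \cap e'| < m$ for all distinct $e, e' \in M$; $\nu^{(m)}(H)$ is the maximum size of an $m$-matching. An $m$-cover is a set $C \subseteq \binom{V}{m}$ such that every edge of $H$ contains some member of $C$; $\tau^{(m)}(H)$ is the minimum size of an $m$-cover. $g_1(k,m)$ is the supremum of $\tau^{(m)}(H)/\nu^{(m)}(H)$ over all finite $k$-uniform hypergraphs $H$ with $\nu^{(m)}(H) = 1$. -}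

module Defs where

open import Data.Nat using (ℕ; _<_; _≤_)
open import Data.Fin.Subset using (Subset; _⊆_; _∩_; ∣_∣)
open import Data.List using (List; length)
open import Data.List.Membership.Propositional using (_∈_)
open import Data.List.Relation.Unary.All using (All)
open import Data.List.Relation.Unary.Any using (Any)
open import Data.List.Relation.Unary.AllPairs using (AllPairs)
open import Data.List.Relation.Unary.Unique.Propositional using (Unique)
open import Data.Product using (_×_; Σ)
open import Relation.Binary.PropositionalEquality using (_≡_)

Hypergraph : ℕ → Set
Hypergraph n = List (Subset n)

Uniform : ∀ {n} → ℕ → Hypergraph n → Set
Uniform k H = All (λ e → ∣ e ∣ ≡ k) H

IsMMatching : ∀ {n} → ℕ → Hypergraph n → List (Subset n) → Set
IsMMatching m H M =
  All (λ e → e ∈ H) M × Unique M × AllPairs (λ e e′ → ∣ e ∩ e′ ∣ < m) M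

MatchingNumber : ∀ {n} → ℕ → Hypergraph n → ℕ → Set
MatchingNumber {n} m H s =
  Σ (List (Subset n)) (λ M → IsMMatching m H M × length M ≡ s)
  × (∀ (M : List (Subset n)) → IsMMatching m H M → length M ≤ s)

IsMCover : ∀ {n} → ℕ → Hypergraph n → List (Subset n) → Set
IsMCover m H C =
  All (λ c → ∣ c ∣ ≡ m) C × All (λ e → Any (λ c → c ⊆ e) C) H

CoverNumberAtMost : ∀ {n} → ℕ → Hypergraph n → ℕ → Set
CoverNumberAtMost {n} m H t =
  Σ (List (Subset n)) (λ C → IsMCover m H C × length C ≤ t)

{-# OPTIONS --safe #-}
module Submission where

-- Any two edges share at least m vertices, since two sharing fewer would form an m-matching of
-- size 2. Fix an edge e and a nonempty D ⊆ e. The m-subsets of e that do not contain D number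
-- C(k,m) − C(k−|D|, m−|D|), and they cover every edge g except those with D ⊆ g and |g ∩ e| = m
-- (otherwise g ∩ e has an m-subset missing a vertex of D). So it suffices to cover these
-- exceptional edges by a patch of at most C(k−|D|, m−|D|) − m further m-sets.
--
-- If no edge meets e in exactly m vertices, D a single vertex needs an empty patch. Otherwise let
-- f be such an edge, d = k − m, A = e ∩ f, E = e ─ f and F = f ─ e, so |E| = |F| = d ≤ m. An
-- exceptional edge g meets f in at least m vertices, hence |g ∩ E| ≤ |g ∩ F|, and it contains D:
--  * m = r + β with 2 ≤ r ≤ β ≤ d: take D ⊆ E with |D| = β; then g meets a fixed subset F′ ⊆ F
--    of size r + d − β in at least r vertices, so the sets D ∪ S with S ⊆ F′, |S| = r, form a patch;
--  * m = 2d + r: take D = E; then F ⊆ g, and g meets a fixed subset A′ ⊆ A of size d + r in at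
--    least r vertices, so the sets E ∪ F ∪ S with S ⊆ A′, |S| = r, form a patch;
--  * m = d = 3: take D a vertex of E; then g contains two vertices of A or two of F.
-- As k ≥ 6, one of the three cases applies; the patches of the first two are small enough because
-- C(n,j) + b·n ≤ C(n+b,j) for 2 ≤ j ≤ n.

open import Defs
open import Data.Bool.Properties using () renaming (_≟_ to _≟ᵇ_)
open import Data.Empty using (⊥-elim)
open import Data.Fin using (zero; suc)
open import Data.Fin.Subset
  using (Subset; inside; outside; ⊥; ⊤; ⁅_⁆; _∩_; _∪_; _─_; _-_; _⊆_; _⊈_; ∣_∣; Nonempty)
  renaming (_∈_ to _∈ₛ_; _∉_ to _∉ₛ_)
open import Data.Fin.Subset.Properties
  using (⊥⊆; ⊆-refl; ⊆-trans; ⊆-antisym; s⊆s; out⊆; drop-∷-⊆; _⊆?_; ∣⊥∣≡0; ∣⁅x⁆∣≡1; x∈⁅x⁆;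
         ∩-identityˡ; ∩-comm; ∩-idem; p∩q⊆p; p∩q⊆q; x∈p∩q⁺; x∈p∪q⁻; p─q⊆p; p⊆q⇒∣p∣≤∣q∣;
         ∣p∩q∣≤∣q∣)
open import Data.List using (List; []; _∷_; [_]; map; _++_; length)
open import Data.List.Membership.Propositional using (_∈_; find; lose)
open import Data.List.Membership.Propositional.Properties using (∈-map⁺; ∈-++⁺ˡ; ∈-++⁺ʳ)
open import Data.List.Properties using (length-map; length-++)
open import Data.List.Relation.Unary.All as All using (All; []; _∷_)
import Data.List.Relation.Unary.All.Properties as All
open import Data.List.Relation.Unary.AllPairs using ([]; _∷_)
open import Data.List.Relation.Unary.Any as Any using (Any; here; there; any?)
import Data.List.Relation.Unary.Any.Properties as Any
open import Data.Nat using (ℕ; zero; suc; _+_; _*_; _∸_; _≤_; _<_; z≤n; s≤s; _≟_; _≤?_; ⌊_/2⌋; ⌈_/2⌉)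
open import Data.Nat.Combinatorics using (_C_; nC1≡n; nCk≡nC[n∸k]; nCk+nC[k+1]≡[n+1]C[k+1])
open import Data.Nat.Properties
open import Algebra.Properties.CommutativeSemigroup +-commutativeSemigroup
  using (interchange; xy∙z≈xz∙y; x∙yz≈y∙xz)
open import Data.Nat.Tactic.RingSolver using (solve-∀)
open import Data.Product using (∃-syntax; _×_; _,_)
open import Data.Sum using (inj₁; inj₂; [_,_]′)
open import Data.Vec using ([]; _∷_)
open import Data.Vec.Base using (here; there)
open import Data.Vec.Properties using (≡-dec)
open import Function using (_∘_)
open import Relation.Binary.PropositionalEquality
  using (_≡_; refl; sym; trans; cong; cong₂; subst; subst₂; module ≡-Reasoning)
open import Relation.Nullary using (¬_; yes; no)

variable
  n r j : ℕ
  p q s t D Y : Subset n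

Disjoint : Subset n → Subset n → Set
Disjoint p q = ∀ {x} → x ∈ₛ p → x ∉ₛ q

inside∷p⊈outside∷q : inside ∷ p ⊈ outside ∷ q
inside∷p⊈outside∷q p⊆q with () ← p⊆q here

⊆-∩ : s ⊆ p → s ⊆ q → s ⊆ p ∩ q
⊆-∩ s⊆p s⊆q x∈s = x∈p∩q⁺ (s⊆p x∈s , s⊆q x∈s)

∪-⊆ : p ⊆ s → q ⊆ s → p ∪ q ⊆ s
∪-⊆ {p = p} {q = q} p⊆s q⊆s x∈p∪q = [ p⊆s , q⊆s ]′ (x∈p∪q⁻ p q x∈p∪q)

⊆⇒∩≡ : p ⊆ q → q ∩ p ≡ p
⊆⇒∩≡ {q = q} p⊆q = ⊆-antisym (p∩q⊆q q _) (⊆-∩ p⊆q ⊆-refl)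

disjoint-mono : p ⊆ q → s ⊆ t → Disjoint q t → Disjoint p s
disjoint-mono p⊆q s⊆t q#t x∈p x∈s = q#t (p⊆q x∈p) (s⊆t x∈s)

∪-disjoint : Disjoint p s → Disjoint q s → Disjoint (p ∪ q) s
∪-disjoint {p = p} {q = q} p#s q#s x∈p∪q = [ p#s , q#s ]′ (x∈p∪q⁻ p q x∈p∪q)

─-disjoint : ∀ (p q : Subset n) → Disjoint (p ─ q) q
─-disjoint (inside ∷ p) (outside ∷ q) here ()
─-disjoint (_ ∷ p) (_ ∷ q) (there x∈p─q) (there x∈q) = ─-disjoint p q x∈p─q x∈q

∣p∣≡0⇒p≡⊥ : ∣ p ∣ ≡ 0 → p ≡ ⊥
∣p∣≡0⇒p≡⊥ {p = []} _ = refl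
∣p∣≡0⇒p≡⊥ {p = outside ∷ p} ∣p∣≡0 = cong (outside ∷_) (∣p∣≡0⇒p≡⊥ ∣p∣≡0)

∣p∣>0⇒Nonempty : 0 < ∣ p ∣ → Nonempty p
∣p∣>0⇒Nonempty {p = inside ∷ p} _ = zero , here
∣p∣>0⇒Nonempty {p = outside ∷ p} ∣p∣>0 with x , x∈p ← ∣p∣>0⇒Nonempty ∣p∣>0 = suc x , there x∈p

subset-of-size : ∀ r → r ≤ ∣ p ∣ → ∃[ q ] q ⊆ p × ∣ q ∣ ≡ r
subset-of-size {n} zero _ = ⊥ , ⊥⊆ , ∣⊥∣≡0 n
subset-of-size {p = inside ∷ p} (suc r) (s≤s r≤∣p∣) with q , q⊆p , ∣q∣≡r ← subset-of-size r r≤∣p∣ =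
  inside ∷ q , s⊆s q⊆p , cong suc ∣q∣≡r
subset-of-size {p = outside ∷ p} (suc r) r<∣p∣ with q , q⊆p , ∣q∣≡r ← subset-of-size (suc r) r<∣p∣ =
  outside ∷ q , out⊆ q⊆p , ∣q∣≡r

∣p∪q∣≡∣p∣+∣q∣ : Disjoint p q → ∣ p ∪ q ∣ ≡ ∣ p ∣ + ∣ q ∣
∣p∪q∣≡∣p∣+∣q∣ {p = []} {q = []} _ = refl
∣p∪q∣≡∣p∣+∣q∣ {p = inside ∷ p} {q = inside ∷ q} p#q = ⊥-elim (p#q here here)
∣p∪q∣≡∣p∣+∣q∣ {p = inside ∷ p} {q = outside ∷ q} p#q =
  cong suc (∣p∪q∣≡∣p∣+∣q∣ (λ x∈p x∈q → p#q (there x∈p) (there x∈q)))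
∣p∪q∣≡∣p∣+∣q∣ {p = outside ∷ p} {q = inside ∷ q} p#q =
  trans (cong suc (∣p∪q∣≡∣p∣+∣q∣ (λ x∈p x∈q → p#q (there x∈p) (there x∈q)))) (sym (+-suc _ _))
∣p∪q∣≡∣p∣+∣q∣ {p = outside ∷ p} {q = outside ∷ q} p#q =
  ∣p∪q∣≡∣p∣+∣q∣ (λ x∈p x∈q → p#q (there x∈p) (there x∈q))

∣g∩p∣≡∣g∩[p∩q]∣+∣g∩[p─q]∣ : ∀ (g p q : Subset n) → ∣ g ∩ p ∣ ≡ ∣ g ∩ (p ∩ q) ∣ + ∣ g ∩ (p ─ q) ∣
∣g∩p∣≡∣g∩[p∩q]∣+∣g∩[p─q]∣ [] [] [] = refl
∣g∩p∣≡∣g∩[p∩q]∣+∣g∩[p─q]∣ (inside ∷ g) (inside ∷ p) (inside ∷ q) = cong suc (∣g∩p∣≡∣g∩[p∩q]∣+∣g∩[p─q]∣ g p q)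
∣g∩p∣≡∣g∩[p∩q]∣+∣g∩[p─q]∣ (inside ∷ g) (inside ∷ p) (outside ∷ q) =
  trans (cong suc (∣g∩p∣≡∣g∩[p∩q]∣+∣g∩[p─q]∣ g p q)) (sym (+-suc _ _))
∣g∩p∣≡∣g∩[p∩q]∣+∣g∩[p─q]∣ (inside ∷ g) (outside ∷ p) (inside ∷ q) = ∣g∩p∣≡∣g∩[p∩q]∣+∣g∩[p─q]∣ g p q
∣g∩p∣≡∣g∩[p∩q]∣+∣g∩[p─q]∣ (inside ∷ g) (outside ∷ p) (outside ∷ q) = ∣g∩p∣≡∣g∩[p∩q]∣+∣g∩[p─q]∣ g p q
∣g∩p∣≡∣g∩[p∩q]∣+∣g∩[p─q]∣ (outside ∷ g) (_ ∷ p) (_ ∷ q) = ∣g∩p∣≡∣g∩[p∩q]∣+∣g∩[p─q]∣ g p q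

∣p∣≡∣p∩q∣+∣p─q∣ : ∀ (p q : Subset n) → ∣ p ∣ ≡ ∣ p ∩ q ∣ + ∣ p ─ q ∣
∣p∣≡∣p∩q∣+∣p─q∣ p q = begin
  ∣ p ∣                             ≡⟨ ∣⊤∩s∣ p ⟨
  ∣ ⊤ ∩ p ∣                         ≡⟨ ∣g∩p∣≡∣g∩[p∩q]∣+∣g∩[p─q]∣ ⊤ p q ⟩
  ∣ ⊤ ∩ (p ∩ q) ∣ + ∣ ⊤ ∩ (p ─ q) ∣ ≡⟨ cong₂ _+_ (∣⊤∩s∣ (p ∩ q)) (∣⊤∩s∣ (p ─ q)) ⟩
  ∣ p ∩ q ∣ + ∣ p ─ q ∣             ∎
  where
  open ≡-Reasoning
  ∣⊤∩s∣ : ∀ (s : Subset n) → ∣ ⊤ ∩ s ∣ ≡ ∣ s ∣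
  ∣⊤∩s∣ s = cong ∣_∣ (∩-identityˡ s)

∣q∣≡∣p∣+∣q─p∣ : p ⊆ q → ∣ q ∣ ≡ ∣ p ∣ + ∣ q ─ p ∣
∣q∣≡∣p∣+∣q─p∣ {p = p} {q = q} p⊆q =
  trans (∣p∣≡∣p∩q∣+∣p─q∣ q p) (cong (λ s → ∣ s ∣ + ∣ q ─ p ∣) (⊆⇒∩≡ p⊆q))

∣p∣≤1+∣p-x∣ : ∀ (p : Subset n) x → ∣ p ∣ ≤ suc ∣ p - x ∣
∣p∣≤1+∣p-x∣ p x = begin
  ∣ p ∣                     ≡⟨ ∣p∣≡∣p∩q∣+∣p─q∣ p ⁅ x ⁆ ⟩
  ∣ p ∩ ⁅ x ⁆ ∣ + ∣ p - x ∣ ≤⟨ +-monoˡ-≤ ∣ p - x ∣ (≤-trans (∣p∩q∣≤∣q∣ p ⁅ x ⁆) (≤-reflexive (∣⁅x⁆∣≡1 x))) ⟩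
  suc ∣ p - x ∣             ∎
  where open ≤-Reasoning

∣p∣+t≡∣q∣⇒∣q─p∣≡t : ∀ {t} → p ⊆ q → ∣ p ∣ + t ≡ ∣ q ∣ → ∣ q ─ p ∣ ≡ t
∣p∣+t≡∣q∣⇒∣q─p∣≡t {p = p} p⊆q ∣p∣+t≡∣q∣ =
  +-cancelˡ-≡ ∣ p ∣ _ _ (trans (sym (∣q∣≡∣p∣+∣q─p∣ p⊆q)) (sym ∣p∣+t≡∣q∣))

∣g∩q∣≤∣g∩p∣+∣q─p∣ : ∀ (g : Subset n) → p ⊆ q → ∣ g ∩ q ∣ ≤ ∣ g ∩ p ∣ + ∣ q ─ p ∣
∣g∩q∣≤∣g∩p∣+∣q─p∣ {p = p} {q = q} g p⊆q = begin
  ∣ g ∩ q ∣                         ≡⟨ ∣g∩p∣≡∣g∩[p∩q]∣+∣g∩[p─q]∣ g q p ⟩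
  ∣ g ∩ (q ∩ p) ∣ + ∣ g ∩ (q ─ p) ∣ ≡⟨ cong (λ s → ∣ g ∩ s ∣ + ∣ g ∩ (q ─ p) ∣) (⊆⇒∩≡ p⊆q) ⟩
  ∣ g ∩ p ∣ + ∣ g ∩ (q ─ p) ∣       ≤⟨ +-monoʳ-≤ (∣ g ∩ p ∣) (∣p∩q∣≤∣q∣ g (q ─ p)) ⟩
  ∣ g ∩ p ∣ + ∣ q ─ p ∣             ∎
  where open ≤-Reasoning

r+t≤∣g∩q∣⇒r≤∣g∩p∣ : ∀ {t} (g : Subset n) → p ⊆ q → ∣ p ∣ + t ≡ ∣ q ∣ → r + t ≤ ∣ g ∩ q ∣ → r ≤ ∣ g ∩ p ∣
r+t≤∣g∩q∣⇒r≤∣g∩p∣ {p = p} {q = q} {r = r} {t} g p⊆q ∣p∣+t≡∣q∣ r+t≤∣g∩q∣ = +-cancelʳ-≤ t r _ (begin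
  r + t                 ≤⟨ r+t≤∣g∩q∣ ⟩
  ∣ g ∩ q ∣             ≤⟨ ∣g∩q∣≤∣g∩p∣+∣q─p∣ g p⊆q ⟩
  ∣ g ∩ p ∣ + ∣ q ─ p ∣ ≡⟨ cong (∣ g ∩ p ∣ +_) (∣p∣+t≡∣q∣⇒∣q─p∣≡t p⊆q ∣p∣+t≡∣q∣) ⟩
  ∣ g ∩ p ∣ + t         ∎)
  where open ≤-Reasoning

∣p∣≤∣g∩p∣⇒p⊆g : ∀ (g p : Subset n) → ∣ p ∣ ≤ ∣ g ∩ p ∣ → p ⊆ g
∣p∣≤∣g∩p∣⇒p⊆g [] [] _ ()
∣p∣≤∣g∩p∣⇒p⊆g (inside ∷ g) (inside ∷ p) (s≤s ∣p∣≤∣g∩p∣) = s⊆s (∣p∣≤∣g∩p∣⇒p⊆g g p ∣p∣≤∣g∩p∣)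
∣p∣≤∣g∩p∣⇒p⊆g (outside ∷ g) (inside ∷ p) ∣p∣<∣g∩p∣ = ⊥-elim (<⇒≱ (s≤s (∣p∩q∣≤∣q∣ g p)) ∣p∣<∣g∩p∣)
∣p∣≤∣g∩p∣⇒p⊆g (inside ∷ g) (outside ∷ p) ∣p∣≤∣g∩p∣ = out⊆ (∣p∣≤∣g∩p∣⇒p⊆g g p ∣p∣≤∣g∩p∣)
∣p∣≤∣g∩p∣⇒p⊆g (outside ∷ g) (outside ∷ p) ∣p∣≤∣g∩p∣ = out⊆ (∣p∣≤∣g∩p∣⇒p⊆g g p ∣p∣≤∣g∩p∣)

0<nCk : ∀ {n k} → k ≤ n → 0 < n C k
0<nCk {k = zero} _ = s≤s z≤n
0<nCk {suc n} {suc k} (s≤s k≤n) =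
  ≤-trans (0<nCk k≤n) (≤-trans (m≤m+n _ _) (≤-reflexive (nCk+nC[k+1]≡[n+1]C[k+1] n k)))

n≤nCk : ∀ {n k} → 0 < k → k < n → n ≤ n C k
n≤nCk {n} {suc zero} _ _ = ≤-reflexive (sym (nC1≡n n))
n≤nCk {suc n} {suc (suc k)} _ (s≤s k<n) = begin
  suc n                       ≡⟨ +-comm 1 n ⟩
  n + 1                       ≤⟨ +-mono-≤ (n≤nCk (s≤s z≤n) k<n) (0<nCk k<n) ⟩
  n C suc k + n C suc (suc k) ≡⟨ nCk+nC[k+1]≡[n+1]C[k+1] n (suc k) ⟩
  suc n C suc (suc k)         ∎
  where open ≤-Reasoning

nCk+b*n≤[n+b]Ck : ∀ {n k} b → 2 ≤ k → k ≤ n → n C k + b * n ≤ (n + b) C k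
nCk+b*n≤[n+b]Ck {n} {k} zero _ _ = ≤-reflexive (trans (+-identityʳ _) (cong (_C k) (sym (+-identityʳ n))))
nCk+b*n≤[n+b]Ck {n} {suc k} (suc b) (s≤s 1≤k) k<n = begin
  n C suc k + (n + b * n)       ≡⟨ x∙yz≈y∙xz (n C suc k) n (b * n) ⟩
  n + (n C suc k + b * n)       ≤⟨ +-mono-≤ (≤-trans (m≤m+n n b) (n≤nCk 1≤k (≤-trans k<n (m≤m+n n b))))
                                            (nCk+b*n≤[n+b]Ck b (s≤s 1≤k) k<n) ⟩
  (n + b) C k + (n + b) C suc k ≡⟨ nCk+nC[k+1]≡[n+1]C[k+1] (n + b) k ⟩
  suc (n + b) C suc k           ≡⟨ cong (_C suc k) (+-suc n b) ⟨
  (n + suc b) C suc k           ∎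
  where open ≤-Reasoning

[p+q]Cq≡[p+q]Cp : ∀ p q → (p + q) C q ≡ (p + q) C p
[p+q]Cq≡[p+q]Cp p q = trans (nCk≡nC[n∸k] (m≤n+m q p)) (cong ((p + q) C_) (m+n∸n≡m p q))

balanced-fits : ∀ r t δ → 2 ≤ r → (r + δ) C r + (r + (r + t)) ≤ ((r + δ) + (r + t)) C r
balanced-fits r t δ 2≤r = begin
  (r + δ) C r + (r + (r + t))     ≤⟨ +-monoʳ-≤ ((r + δ) C r) r+[r+t]≤[r+t]*[r+δ] ⟩
  (r + δ) C r + (r + t) * (r + δ) ≤⟨ nCk+b*n≤[n+b]Ck (r + t) 2≤r (m≤m+n r δ) ⟩
  ((r + δ) + (r + t)) C r         ∎
  where
  open ≤-Reasoning
  r+[r+t]≤[r+t]*[r+δ] : r + (r + t) ≤ (r + t) * (r + δ)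
  r+[r+t]≤[r+t]*[r+δ] = begin
    r + (r + t)           ≤⟨ +-monoˡ-≤ (r + t) (m≤m+n r t) ⟩
    (r + t) + (r + t)     ≡⟨ cong ((r + t) +_) (+-identityʳ (r + t)) ⟨
    2 * (r + t)           ≡⟨ *-comm 2 (r + t) ⟩
    (r + t) * 2           ≤⟨ *-monoʳ-≤ (r + t) (≤-trans 2≤r (m≤m+n r δ)) ⟩
    (r + t) * (r + δ)     ∎

lopsided-fits : ∀ d r → 2 ≤ d → (d + r) C r + (d + d + r) ≤ (d + d + r) C (d + r)
lopsided-fits d r 2≤d = begin
  (d + r) C r + (d + d + r)   ≡⟨ cong (_+ (d + d + r)) ([p+q]Cq≡[p+q]Cp d r) ⟩
  (d + r) C d + (d + d + r)   ≤⟨ +-monoʳ-≤ ((d + r) C d) d+d+r≤d*[d+r] ⟩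
  (d + r) C d + d * (d + r)   ≤⟨ nCk+b*n≤[n+b]Ck d 2≤d (m≤m+n d r) ⟩
  ((d + r) + d) C d           ≡⟨ cong (_C d) (+-comm (d + r) d) ⟩
  (d + (d + r)) C d           ≡⟨ [p+q]Cq≡[p+q]Cp d (d + r) ⟨
  (d + (d + r)) C (d + r)     ≡⟨ cong (_C (d + r)) (+-assoc d d r) ⟨
  (d + d + r) C (d + r)       ∎
  where
  open ≤-Reasoning
  d+d+r≤d*[d+r] : d + d + r ≤ d * (d + r)
  d+d+r≤d*[d+r] = begin
    d + d + r               ≤⟨ m≤m+n (d + d + r) r ⟩
    d + d + r + r           ≡⟨ shuffle d r ⟩
    2 * (d + r)             ≤⟨ *-monoˡ-≤ (d + r) 2≤d ⟩
    d * (d + r)             ∎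
    where
    shuffle : ∀ d r → d + d + r + r ≡ 2 * (d + r)
    shuffle = solve-∀

infixr 5 _⊕_

_⊕_ : List (Subset n) → List (Subset n) → List (Subset (suc n))
xs ⊕ ys = map (inside ∷_) xs ++ map (outside ∷_) ys

length-⊕ : ∀ (xs ys : List (Subset n)) → length (xs ⊕ ys) ≡ length xs + length ys
length-⊕ xs ys = trans (length-++ (map (inside ∷_) xs)) (cong₂ _+_ (length-map _ xs) (length-map _ ys))

All-⊕ : ∀ {P : Subset (suc n) → Set} {xs ys} →
        All (P ∘ (inside ∷_)) xs → All (P ∘ (outside ∷_)) ys → All P (xs ⊕ ys)
All-⊕ Pxs Pys = All.++⁺ (All.map⁺ Pxs) (All.map⁺ Pys)

∈-⊕ˡ : ∀ {xs ys : List (Subset n)} → s ∈ xs → inside ∷ s ∈ xs ⊕ ys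
∈-⊕ˡ s∈xs = ∈-++⁺ˡ (∈-map⁺ (inside ∷_) s∈xs)

∈-⊕ʳ : ∀ (xs : List (Subset n)) {ys} → s ∈ ys → outside ∷ s ∈ xs ⊕ ys
∈-⊕ʳ xs s∈ys = ∈-++⁺ʳ (map (inside ∷_) xs) (∈-map⁺ (outside ∷_) s∈ys)

combinations : ℕ → Subset n → List (Subset n)
combinations zero    _             = [ ⊥ ]
combinations (suc r) []            = []
combinations (suc r) (inside ∷ p)  = combinations r p ⊕ combinations (suc r) p
combinations (suc r) (outside ∷ p) = [] ⊕ combinations (suc r) p

length-combinations : ∀ r (p : Subset n) → length (combinations r p) ≡ ∣ p ∣ C r
length-combinations zero    _             = refl
length-combinations (suc r) []            = refl
length-combinations (suc r) (inside ∷ p)  = begin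
  length (combinations r p ⊕ combinations (suc r) p)           ≡⟨ length-⊕ (combinations r p) _ ⟩
  length (combinations r p) + length (combinations (suc r) p) ≡⟨ cong₂ _+_ (length-combinations r p)
                                                                          (length-combinations (suc r) p) ⟩
  ∣ p ∣ C r + ∣ p ∣ C suc r                                   ≡⟨ nCk+nC[k+1]≡[n+1]C[k+1] ∣ p ∣ r ⟩
  suc ∣ p ∣ C suc r                                           ∎
  where open ≡-Reasoning
length-combinations (suc r) (outside ∷ p) =
  trans (length-⊕ [] (combinations (suc r) p)) (length-combinations (suc r) p)

combinations-size : ∀ r (p : Subset n) → All (λ s → ∣ s ∣ ≡ r) (combinations r p)
combinations-size {n} zero _     = ∣⊥∣≡0 n ∷ []
combinations-size (suc r) []            = []
combinations-size (suc r) (inside ∷ p)  =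
  All-⊕ (All.map (cong suc) (combinations-size r p)) (combinations-size (suc r) p)
combinations-size (suc r) (outside ∷ p) = All-⊕ [] (combinations-size (suc r) p)

combinations-⊆ : ∀ r (p : Subset n) → All (_⊆ p) (combinations r p)
combinations-⊆ zero    _             = ⊥⊆ ∷ []
combinations-⊆ (suc r) []            = []
combinations-⊆ (suc r) (inside ∷ p)  =
  All-⊕ (All.map s⊆s (combinations-⊆ r p)) (All.map out⊆ (combinations-⊆ (suc r) p))
combinations-⊆ (suc r) (outside ∷ p) = All-⊕ [] (All.map out⊆ (combinations-⊆ (suc r) p))

combinations-complete : s ⊆ p → ∣ s ∣ ≡ r → s ∈ combinations r p
combinations-complete {r = zero} _ ∣s∣≡0 = here (∣p∣≡0⇒p≡⊥ ∣s∣≡0)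
combinations-complete {s = inside ∷ s} {inside ∷ p} {suc r} s⊆p ∣s∣≡1+r =
  ∈-⊕ˡ (combinations-complete (drop-∷-⊆ s⊆p) (suc-injective ∣s∣≡1+r))
combinations-complete {s = outside ∷ s} {inside ∷ p} {suc r} s⊆p ∣s∣≡1+r =
  ∈-⊕ʳ (combinations r p) (combinations-complete (drop-∷-⊆ s⊆p) ∣s∣≡1+r)
combinations-complete {s = inside ∷ s} {outside ∷ p} s⊆p _ = ⊥-elim (inside∷p⊈outside∷q s⊆p)
combinations-complete {s = outside ∷ s} {outside ∷ p} {suc r} s⊆p ∣s∣≡1+r =
  ∈-⊕ʳ [] (combinations-complete (drop-∷-⊆ s⊆p) ∣s∣≡1+r)

extensions : ℕ → Subset n → Subset n → List (Subset n)
extensions r p q = map (p ∪_) (combinations r q)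

length-extensions : ∀ r (p q : Subset n) → length (extensions r p q) ≡ ∣ q ∣ C r
length-extensions r p q = trans (length-map (p ∪_) (combinations r q)) (length-combinations r q)

extensions-size : ∀ r → Disjoint p q → All (λ s → ∣ s ∣ ≡ ∣ p ∣ + r) (extensions r p q)
extensions-size {p = p} {q = q} r p#q =
  All.map⁺ (All.zipWith size (combinations-size r q , combinations-⊆ r q))
  where
  size : ∀ {s} → ∣ s ∣ ≡ r × s ⊆ q → ∣ p ∪ s ∣ ≡ ∣ p ∣ + r
  size (∣s∣≡r , s⊆q) = trans (∣p∪q∣≡∣p∣+∣q∣ (disjoint-mono ⊆-refl s⊆q p#q)) (cong (∣ p ∣ +_) ∣s∣≡r)

extensions-hit : ∀ {g} r → p ⊆ g → r ≤ ∣ g ∩ q ∣ → Any (_⊆ g) (extensions r p q)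
extensions-hit {p = p} {q = q} {g} r p⊆g r≤∣g∩q∣ with s , s⊆g∩q , ∣s∣≡r ← subset-of-size r r≤∣g∩q∣ =
  lose (∈-map⁺ (p ∪_) (combinations-complete (⊆-trans s⊆g∩q (p∩q⊆q g q)) ∣s∣≡r))
       (∪-⊆ p⊆g (⊆-trans s⊆g∩q (p∩q⊆p g q)))

-- The r-subsets of Y that do not include all of D.
avoiding : ℕ → Subset n → Subset n → List (Subset n)
avoiding _       []            []            = []
avoiding r       (outside ∷ D) (outside ∷ Y) = [] ⊕ avoiding r D Y
avoiding r       (inside ∷ D)  (outside ∷ Y) = [] ⊕ combinations r Y
avoiding zero    (outside ∷ D) (inside ∷ Y)  = [] ⊕ avoiding zero D Y
avoiding zero    (inside ∷ D)  (inside ∷ Y)  = [] ⊕ combinations zero Y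
avoiding (suc r) (outside ∷ D) (inside ∷ Y)  = avoiding r D Y ⊕ avoiding (suc r) D Y
avoiding (suc r) (inside ∷ D)  (inside ∷ Y)  = avoiding r D Y ⊕ combinations (suc r) Y

avoiding-size : ∀ r (D Y : Subset n) → All (λ s → ∣ s ∣ ≡ r) (avoiding r D Y)
avoiding-size _       []            []            = []
avoiding-size r       (outside ∷ D) (outside ∷ Y) = All-⊕ [] (avoiding-size r D Y)
avoiding-size r       (inside ∷ D)  (outside ∷ Y) = All-⊕ [] (combinations-size r Y)
avoiding-size zero    (outside ∷ D) (inside ∷ Y)  = All-⊕ [] (avoiding-size zero D Y)
avoiding-size zero    (inside ∷ D)  (inside ∷ Y)  = All-⊕ [] (combinations-size zero Y)
avoiding-size (suc r) (outside ∷ D) (inside ∷ Y)  =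
  All-⊕ (All.map (cong suc) (avoiding-size r D Y)) (avoiding-size (suc r) D Y)
avoiding-size (suc r) (inside ∷ D)  (inside ∷ Y)  =
  All-⊕ (All.map (cong suc) (avoiding-size r D Y)) (combinations-size (suc r) Y)

avoiding-complete : s ⊆ Y → ∣ s ∣ ≡ r → D ⊈ s → s ∈ avoiding r D Y
avoiding-complete {s = []} {D = []} _ _ D⊈s = ⊥-elim (D⊈s λ ())
avoiding-complete {s = inside ∷ s} {outside ∷ Y} s⊆Y = ⊥-elim (inside∷p⊈outside∷q s⊆Y)
avoiding-complete {s = outside ∷ s} {outside ∷ Y} {D = outside ∷ D} s⊆Y ∣s∣≡r D⊈s =
  ∈-⊕ʳ [] (avoiding-complete (drop-∷-⊆ s⊆Y) ∣s∣≡r (D⊈s ∘ out⊆))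
avoiding-complete {s = outside ∷ s} {outside ∷ Y} {D = inside ∷ D} s⊆Y ∣s∣≡r _ =
  ∈-⊕ʳ [] (combinations-complete (drop-∷-⊆ s⊆Y) ∣s∣≡r)
avoiding-complete {s = outside ∷ s} {inside ∷ Y} {zero} {outside ∷ D} s⊆Y ∣s∣≡0 D⊈s =
  ∈-⊕ʳ [] (avoiding-complete (drop-∷-⊆ s⊆Y) ∣s∣≡0 (D⊈s ∘ out⊆))
avoiding-complete {s = outside ∷ s} {inside ∷ Y} {zero} {inside ∷ D} s⊆Y ∣s∣≡0 _ =
  ∈-⊕ʳ [] (combinations-complete (drop-∷-⊆ s⊆Y) ∣s∣≡0)
avoiding-complete {s = inside ∷ s} {inside ∷ Y} {suc r} {outside ∷ D} s⊆Y ∣s∣≡1+r D⊈s =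
  ∈-⊕ˡ (avoiding-complete (drop-∷-⊆ s⊆Y) (suc-injective ∣s∣≡1+r) (D⊈s ∘ out⊆))
avoiding-complete {s = outside ∷ s} {inside ∷ Y} {suc r} {outside ∷ D} s⊆Y ∣s∣≡1+r D⊈s =
  ∈-⊕ʳ (avoiding r D Y) (avoiding-complete (drop-∷-⊆ s⊆Y) ∣s∣≡1+r (D⊈s ∘ out⊆))
avoiding-complete {s = inside ∷ s} {inside ∷ Y} {suc r} {inside ∷ D} s⊆Y ∣s∣≡1+r D⊈s =
  ∈-⊕ˡ (avoiding-complete (drop-∷-⊆ s⊆Y) (suc-injective ∣s∣≡1+r) (D⊈s ∘ s⊆s))
avoiding-complete {s = outside ∷ s} {inside ∷ Y} {suc r} {inside ∷ D} s⊆Y ∣s∣≡1+r _ =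
  ∈-⊕ʳ (avoiding r D Y) (combinations-complete (drop-∷-⊆ s⊆Y) ∣s∣≡1+r)

length-avoiding-short : ∀ r (D Y : Subset n) → r < ∣ D ∣ → length (avoiding r D Y) ≡ ∣ Y ∣ C r
length-avoiding-short r (outside ∷ D) (outside ∷ Y) r<∣D∣ =
  trans (length-⊕ [] (avoiding r D Y)) (length-avoiding-short r D Y r<∣D∣)
length-avoiding-short r (inside ∷ D) (outside ∷ Y) _ =
  trans (length-⊕ [] (combinations r Y)) (length-combinations r Y)
length-avoiding-short zero (outside ∷ D) (inside ∷ Y) r<∣D∣ =
  trans (length-⊕ [] (avoiding zero D Y)) (length-avoiding-short zero D Y r<∣D∣)
length-avoiding-short zero (inside ∷ D) (inside ∷ Y) _ = refl
length-avoiding-short (suc r) (outside ∷ D) (inside ∷ Y) r<∣D∣ = begin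
  length (avoiding r D Y ⊕ avoiding (suc r) D Y)               ≡⟨ length-⊕ (avoiding r D Y) _ ⟩
  length (avoiding r D Y) + length (avoiding (suc r) D Y)     ≡⟨ cong₂ _+_
    (length-avoiding-short r D Y (<-trans (n<1+n r) r<∣D∣)) (length-avoiding-short (suc r) D Y r<∣D∣) ⟩
  ∣ Y ∣ C r + ∣ Y ∣ C suc r                                   ≡⟨ nCk+nC[k+1]≡[n+1]C[k+1] ∣ Y ∣ r ⟩
  suc ∣ Y ∣ C suc r                                           ∎
  where open ≡-Reasoning
length-avoiding-short (suc r) (inside ∷ D) (inside ∷ Y) (s≤s r<∣D∣) = begin
  length (avoiding r D Y ⊕ combinations (suc r) Y)             ≡⟨ length-⊕ (avoiding r D Y) _ ⟩
  length (avoiding r D Y) + length (combinations (suc r) Y)   ≡⟨ cong₂ _+_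
    (length-avoiding-short r D Y r<∣D∣) (length-combinations (suc r) Y) ⟩
  ∣ Y ∣ C r + ∣ Y ∣ C suc r                                   ≡⟨ nCk+nC[k+1]≡[n+1]C[k+1] ∣ Y ∣ r ⟩
  suc ∣ Y ∣ C suc r                                           ∎
  where open ≡-Reasoning

length-avoiding : D ⊆ Y → ∣ D ∣ + j ≡ r → length (avoiding r D Y) + ∣ Y ─ D ∣ C j ≡ ∣ Y ∣ C r
length-avoiding {D = []} {[]} _ refl = refl
length-avoiding {D = outside ∷ D} {outside ∷ Y} {r = r} D⊆Y ∣D∣+j≡r =
  trans (cong (_+ _) (length-⊕ [] (avoiding r D Y))) (length-avoiding (drop-∷-⊆ D⊆Y) ∣D∣+j≡r)
length-avoiding {D = inside ∷ D} {outside ∷ Y} D⊆Y = ⊥-elim (inside∷p⊈outside∷q D⊆Y)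
length-avoiding {D = outside ∷ D} {inside ∷ Y} {r = zero} D⊆Y ∣D∣+j≡0
  with refl ← m+n≡0⇒n≡0 ∣ D ∣ ∣D∣+j≡0 =
  trans (cong (_+ 1) (length-⊕ [] (avoiding zero D Y))) (length-avoiding (drop-∷-⊆ D⊆Y) ∣D∣+j≡0)
length-avoiding {D = outside ∷ D} {inside ∷ Y} {zero} {suc r} D⊆Y ∣D∣+0≡1+r = begin
  length (avoiding r D Y ⊕ avoiding (suc r) D Y) + 1           ≡⟨ cong (_+ 1) (length-⊕ (avoiding r D Y) _) ⟩
  length (avoiding r D Y) + length (avoiding (suc r) D Y) + 1 ≡⟨ +-assoc (length (avoiding r D Y)) _ _ ⟩
  length (avoiding r D Y) + (length (avoiding (suc r) D Y) + 1) ≡⟨ cong₂ _+_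
    (length-avoiding-short r D Y (≤-reflexive (sym (trans (sym (+-identityʳ _)) ∣D∣+0≡1+r))))
    (length-avoiding (drop-∷-⊆ D⊆Y) ∣D∣+0≡1+r) ⟩
  ∣ Y ∣ C r + ∣ Y ∣ C suc r                                      ≡⟨ nCk+nC[k+1]≡[n+1]C[k+1] ∣ Y ∣ r ⟩
  suc ∣ Y ∣ C suc r                                              ∎
  where open ≡-Reasoning
length-avoiding {D = outside ∷ D} {inside ∷ Y} {suc j} {suc r} D⊆Y ∣D∣+1+j≡1+r = begin
  length (avoiding r D Y ⊕ avoiding (suc r) D Y) + suc ∣ Y ─ D ∣ C suc j
    ≡⟨ cong₂ _+_ (length-⊕ (avoiding r D Y) _) (sym (nCk+nC[k+1]≡[n+1]C[k+1] ∣ Y ─ D ∣ j)) ⟩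
  (length (avoiding r D Y) + length (avoiding (suc r) D Y)) + (∣ Y ─ D ∣ C j + ∣ Y ─ D ∣ C suc j)
    ≡⟨ interchange (length (avoiding r D Y)) _ _ _ ⟩
  (length (avoiding r D Y) + ∣ Y ─ D ∣ C j) + (length (avoiding (suc r) D Y) + ∣ Y ─ D ∣ C suc j)
    ≡⟨ cong₂ _+_ (length-avoiding D⊆Y′ (suc-injective (trans (sym (+-suc ∣ D ∣ j)) ∣D∣+1+j≡1+r)))
                 (length-avoiding D⊆Y′ ∣D∣+1+j≡1+r) ⟩
  ∣ Y ∣ C r + ∣ Y ∣ C suc r
    ≡⟨ nCk+nC[k+1]≡[n+1]C[k+1] ∣ Y ∣ r ⟩
  suc ∣ Y ∣ C suc r ∎
  where
  open ≡-Reasoning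
  D⊆Y′ : D ⊆ Y
  D⊆Y′ = drop-∷-⊆ D⊆Y
length-avoiding {D = inside ∷ D} {inside ∷ Y} {j} {suc r} D⊆Y ∣D∣+j≡r = begin
  length (avoiding r D Y ⊕ combinations (suc r) Y) + ∣ Y ─ D ∣ C j
    ≡⟨ cong (_+ _) (length-⊕ (avoiding r D Y) _) ⟩
  length (avoiding r D Y) + length (combinations (suc r) Y) + ∣ Y ─ D ∣ C j
    ≡⟨ xy∙z≈xz∙y (length (avoiding r D Y)) _ _ ⟩
  length (avoiding r D Y) + ∣ Y ─ D ∣ C j + length (combinations (suc r) Y)
    ≡⟨ cong₂ _+_ (length-avoiding (drop-∷-⊆ D⊆Y) (suc-injective ∣D∣+j≡r)) (length-combinations (suc r) Y) ⟩
  ∣ Y ∣ C r + ∣ Y ∣ C suc r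
    ≡⟨ nCk+nC[k+1]≡[n+1]C[k+1] ∣ Y ∣ r ⟩
  suc ∣ Y ∣ C suc r ∎
  where open ≡-Reasoning

avoiding-hit : ∀ {g} → s ⊆ g ∩ Y → ∣ s ∣ ≡ r → D ⊈ s → Any (_⊆ g) (avoiding r D Y)
avoiding-hit {Y = Y} {g = g} s⊆g∩Y ∣s∣≡r D⊈s =
  lose (avoiding-complete (⊆-trans s⊆g∩Y (p∩q⊆q g Y)) ∣s∣≡r D⊈s) (⊆-trans s⊆g∩Y (p∩q⊆p g Y))

avoiding-hit-⊈ : ∀ {g} → D ⊈ g → r ≤ ∣ g ∩ Y ∣ → Any (_⊆ g) (avoiding r D Y)
avoiding-hit-⊈ {Y = Y} {g = g} D⊈g r≤∣g∩Y∣ with s , s⊆g∩Y , ∣s∣≡r ← subset-of-size _ r≤∣g∩Y∣ =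
  avoiding-hit s⊆g∩Y ∣s∣≡r (λ D⊆s → D⊈g (⊆-trans D⊆s (⊆-trans s⊆g∩Y (p∩q⊆p g Y))))

avoiding-hit-< : ∀ {g} → Nonempty D → r < ∣ g ∩ Y ∣ → Any (_⊆ g) (avoiding r D Y)
avoiding-hit-< {r = r} {Y = Y} {g = g} (x , x∈D) r<∣g∩Y∣
  with s , s⊆g∩Y-x , ∣s∣≡r ← subset-of-size r (≤-pred (≤-trans r<∣g∩Y∣ (∣p∣≤1+∣p-x∣ (g ∩ Y) x))) =
  avoiding-hit (⊆-trans s⊆g∩Y-x (p─q⊆p (g ∩ Y) ⁅ x ⁆)) ∣s∣≡r
    (λ D⊆s → ─-disjoint (g ∩ Y) ⁅ x ⁆ (s⊆g∩Y-x (D⊆s x∈D)) (x∈⁅x⁆ x))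

record Patch (m : ℕ) (H : Hypergraph n) (e D : Subset n) : Set where
  field
    sets   : List (Subset n)
    sizes  : All (λ c → ∣ c ∣ ≡ m) sets
    covers : ∀ {g} → g ∈ H → D ⊆ g → ∣ g ∩ e ∣ ≡ m → Any (_⊆ g) sets
open Patch

cover-from-patch : ∀ {m l} {H : Hypergraph n} {e} →
  (∀ {g} → g ∈ H → m ≤ ∣ g ∩ e ∣) → D ⊆ e → 0 < ∣ D ∣ → ∣ D ∣ + j ≡ m → ∣ D ∣ + l ≡ ∣ e ∣ →
  (P : Patch m H e D) → length (sets P) + m ≤ l C j →
  CoverNumberAtMost m H (∣ e ∣ C m ∸ m)
cover-from-patch {D = D} {j = j} {m = m} {l} {H} {e} e-meets D⊆e ∣D∣>0 ∣D∣+j≡m ∣D∣+l≡∣e∣ P fits =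
  avoiding m D e ++ sets P , (All.++⁺ (avoiding-size m D e) (sizes P) , All.tabulate covered) , bound
  where
  covered : ∀ {g} → g ∈ H → Any (_⊆ g) (avoiding m D e ++ sets P)
  covered {g} g∈H with D ⊆? g | m≤n⇒m<n∨m≡n (e-meets g∈H)
  ... | no D⊈g  | _              = Any.++⁺ˡ (avoiding-hit-⊈ D⊈g (e-meets g∈H))
  ... | yes _   | inj₁ m<∣g∩e∣  = Any.++⁺ˡ (avoiding-hit-< {D = D} (∣p∣>0⇒Nonempty ∣D∣>0) m<∣g∩e∣)
  ... | yes D⊆g | inj₂ m≡∣g∩e∣ = Any.++⁺ʳ (avoiding m D e) (covers P g∈H D⊆g (sym m≡∣g∩e∣))
  bound : length (avoiding m D e ++ sets P) ≤ ∣ e ∣ C m ∸ m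
  bound = m+n≤o⇒m≤o∸n _ (begin
    length (avoiding m D e ++ sets P) + m           ≡⟨ cong (_+ m) (length-++ (avoiding m D e)) ⟩
    length (avoiding m D e) + length (sets P) + m   ≡⟨ +-assoc (length (avoiding m D e)) _ _ ⟩
    length (avoiding m D e) + (length (sets P) + m) ≤⟨ +-monoʳ-≤ _ fits ⟩
    length (avoiding m D e) + l C j                 ≡⟨ cong (λ x → length (avoiding m D e) + x C j) ∣e─D∣≡l ⟨
    length (avoiding m D e) + ∣ e ─ D ∣ C j         ≡⟨ length-avoiding D⊆e ∣D∣+j≡m ⟩
    ∣ e ∣ C m                                       ∎)
    where
    open ≤-Reasoning
    ∣e─D∣≡l : ∣ e ─ D ∣ ≡ l
    ∣e─D∣≡l = ∣p∣+t≡∣q∣⇒∣q─p∣≡t D⊆e ∣D∣+l≡∣e∣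

extension-patch : ∀ {m} {H : Hypergraph n} {e} r → Disjoint p q → ∣ p ∣ + r ≡ m →
  (∀ {g} → g ∈ H → D ⊆ g → ∣ g ∩ e ∣ ≡ m → p ⊆ g × r ≤ ∣ g ∩ q ∣) → Patch m H e D
extension-patch {p = p} {q = q} r p#q ∣p∣+r≡m forced = record
  { sets   = extensions r p q
  ; sizes  = All.map (λ ∣s∣≡∣p∣+r → trans ∣s∣≡∣p∣+r ∣p∣+r≡m) (extensions-size r p#q)
  ; covers = λ g∈H D⊆g ∣g∩e∣≡m → let p⊆g , r≤∣g∩q∣ = forced g∈H D⊆g ∣g∩e∣≡m in extensions-hit r p⊆g r≤∣g∩q∣
  }

data Regime : ℕ → ℕ → Set where
  balanced : ∀ {r t δ} → 2 ≤ r → Regime (r + (r + t)) ((r + t) + δ)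
  lopsided : ∀ {d r} → 2 ≤ d → Regime (d + d + r) d
  m≡d≡3    : Regime 3 3

regime : ∀ {m d} → 2 ≤ d → d ≤ m → 6 ≤ m + d → Regime m d
regime {m} {d} 2≤d d≤m 6≤m+d with d + d ≤? m | m ≟ 3
... | yes 2d≤m | _        = subst (λ m → Regime m d) (m+[n∸m]≡n 2d≤m) (lopsided 2≤d)
... | no _     | yes refl = subst (Regime 3) (≤-antisym (+-cancelˡ-≤ 3 3 d 6≤m+d) d≤m) m≡d≡3
... | no 2d≰m  | no m≢3   = subst₂ Regime r+[r+t]≡m [r+t]+δ≡d (balanced 2≤⌊m/2⌋)
  where
  ⌊m/2⌋≤⌈m/2⌉ : ⌊ m /2⌋ ≤ ⌈ m /2⌉
  ⌊m/2⌋≤⌈m/2⌉ = ⌊n/2⌋≤⌈n/2⌉ m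
  ⌈m/2⌉≤d : ⌈ m /2⌉ ≤ d
  ⌈m/2⌉≤d = subst (⌈ m /2⌉ ≤_) (sym (n≡⌈n+n/2⌉ d)) (⌈n/2⌉-mono (<⇒≤ (≰⇒> 2d≰m)))
  3≤m : 3 ≤ m
  3≤m = subst (3 ≤_) (sym (n≡⌊n+n/2⌋ m)) (⌊n/2⌋-mono (≤-trans 6≤m+d (+-monoʳ-≤ m d≤m)))
  2≤⌊m/2⌋ : 2 ≤ ⌊ m /2⌋
  2≤⌊m/2⌋ = ⌊n/2⌋-mono (≤∧≢⇒< 3≤m (m≢3 ∘ sym))
  r+[r+t]≡m : ⌊ m /2⌋ + (⌊ m /2⌋ + (⌈ m /2⌉ ∸ ⌊ m /2⌋)) ≡ m
  r+[r+t]≡m = trans (cong (⌊ m /2⌋ +_) (m+[n∸m]≡n ⌊m/2⌋≤⌈m/2⌉)) (⌊n/2⌋+⌈n/2⌉≡n m)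
  [r+t]+δ≡d : ⌊ m /2⌋ + (⌈ m /2⌉ ∸ ⌊ m /2⌋) + (d ∸ ⌈ m /2⌉) ≡ d
  [r+t]+δ≡d = trans (cong (_+ (d ∸ ⌈ m /2⌉)) (m+[n∸m]≡n ⌊m/2⌋≤⌈m/2⌉)) (m+[n∸m]≡n ⌈m/2⌉≤d)


record TightPair (m d : ℕ) (H : Hypergraph n) (e f : Subset n) : Set where
  field
    e-meets : ∀ {g} → g ∈ H → m ≤ ∣ g ∩ e ∣
    f-meets : ∀ {g} → g ∈ H → m ≤ ∣ g ∩ f ∣
    ∣e∣≡m+d : ∣ e ∣ ≡ m + d
    ∣f∣≡m+d : ∣ f ∣ ≡ m + d
    ∣e∩f∣≡m : ∣ e ∩ f ∣ ≡ m

  A E F : Subset n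
  A = e ∩ f
  E = e ─ f
  F = f ─ e

  ∣p─q∣≡d : ∀ (p q : Subset n) → ∣ p ∣ ≡ m + d → ∣ p ∩ q ∣ ≡ m → ∣ p ─ q ∣ ≡ d
  ∣p─q∣≡d p q ∣p∣≡m+d ∣p∩q∣≡m =
    +-cancelˡ-≡ m _ _ (trans (cong (_+ ∣ p ─ q ∣) (sym ∣p∩q∣≡m)) (trans (sym (∣p∣≡∣p∩q∣+∣p─q∣ p q)) ∣p∣≡m+d))

  ∣E∣≡d : ∣ E ∣ ≡ d
  ∣E∣≡d = ∣p─q∣≡d e f ∣e∣≡m+d ∣e∩f∣≡m

  ∣F∣≡d : ∣ F ∣ ≡ d
  ∣F∣≡d = ∣p─q∣≡d f e ∣f∣≡m+d (trans (cong ∣_∣ (∩-comm f e)) ∣e∩f∣≡m)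

  E#F : Disjoint E F
  E#F = disjoint-mono ⊆-refl (p─q⊆p f e) (─-disjoint e f)

  E#A : Disjoint E A
  E#A = disjoint-mono ⊆-refl (p∩q⊆q e f) (─-disjoint e f)

  F#A : Disjoint F A
  F#A = disjoint-mono ⊆-refl (p∩q⊆p e f) (─-disjoint f e)

  subset-of-A : ∀ {r} → r ≤ m → ∃[ A′ ] A′ ⊆ A × ∣ A′ ∣ ≡ r
  subset-of-A r≤m = subset-of-size _ (subst (_ ≤_) (sym ∣e∩f∣≡m) r≤m)

  subset-of-E : ∀ {r} → r ≤ d → ∃[ E′ ] E′ ⊆ E × ∣ E′ ∣ ≡ r
  subset-of-E r≤d = subset-of-size _ (subst (_ ≤_) (sym ∣E∣≡d) r≤d)

  subset-of-F : ∀ {r} → r ≤ d → ∃[ F′ ] F′ ⊆ F × ∣ F′ ∣ ≡ r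
  subset-of-F r≤d = subset-of-size _ (subst (_ ≤_) (sym ∣F∣≡d) r≤d)

  ∣g∩e∣≡∣g∩A∣+∣g∩E∣ : ∀ g → ∣ g ∩ e ∣ ≡ ∣ g ∩ A ∣ + ∣ g ∩ E ∣
  ∣g∩e∣≡∣g∩A∣+∣g∩E∣ g = ∣g∩p∣≡∣g∩[p∩q]∣+∣g∩[p─q]∣ g e f

  ∣g∩E∣≤∣g∩F∣ : ∀ {g} → g ∈ H → ∣ g ∩ e ∣ ≡ m → ∣ g ∩ E ∣ ≤ ∣ g ∩ F ∣
  ∣g∩E∣≤∣g∩F∣ {g} g∈H ∣g∩e∣≡m = +-cancelˡ-≤ m _ _ (begin
    m + ∣ g ∩ E ∣                             ≤⟨ +-monoˡ-≤ ∣ g ∩ E ∣ (f-meets g∈H) ⟩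
    ∣ g ∩ f ∣ + ∣ g ∩ E ∣                     ≡⟨ cong (_+ ∣ g ∩ E ∣) (∣g∩p∣≡∣g∩[p∩q]∣+∣g∩[p─q]∣ g f e) ⟩
    ∣ g ∩ (f ∩ e) ∣ + ∣ g ∩ F ∣ + ∣ g ∩ E ∣   ≡⟨ cong (λ s → ∣ g ∩ s ∣ + ∣ g ∩ F ∣ + ∣ g ∩ E ∣) (∩-comm f e) ⟩
    ∣ g ∩ A ∣ + ∣ g ∩ F ∣ + ∣ g ∩ E ∣         ≡⟨ xy∙z≈xz∙y ∣ g ∩ A ∣ _ _ ⟩
    ∣ g ∩ A ∣ + ∣ g ∩ E ∣ + ∣ g ∩ F ∣         ≡⟨ cong (_+ ∣ g ∩ F ∣) (∣g∩e∣≡∣g∩A∣+∣g∩E∣ g) ⟨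
    ∣ g ∩ e ∣ + ∣ g ∩ F ∣                     ≡⟨ cong (_+ ∣ g ∩ F ∣) ∣g∩e∣≡m ⟩
    m + ∣ g ∩ F ∣                             ∎)
    where open ≤-Reasoning

  ∣D∣≤∣g∩F∣ : ∀ {g} → D ⊆ E → g ∈ H → D ⊆ g → ∣ g ∩ e ∣ ≡ m → ∣ D ∣ ≤ ∣ g ∩ F ∣
  ∣D∣≤∣g∩F∣ D⊆E g∈H D⊆g ∣g∩e∣≡m = ≤-trans (p⊆q⇒∣p∣≤∣q∣ (⊆-∩ D⊆g D⊆E)) (∣g∩E∣≤∣g∩F∣ g∈H ∣g∩e∣≡m)

  E⊆g⇒F⊆g : ∀ {g} → g ∈ H → E ⊆ g → ∣ g ∩ e ∣ ≡ m → F ⊆ g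
  E⊆g⇒F⊆g {g} g∈H E⊆g ∣g∩e∣≡m =
    ∣p∣≤∣g∩p∣⇒p⊆g g F (subst (_≤ ∣ g ∩ F ∣) (trans ∣E∣≡d (sym ∣F∣≡d)) (∣D∣≤∣g∩F∣ ⊆-refl g∈H E⊆g ∣g∩e∣≡m))

  E⊆g⇒∣g∩A∣+d≡m : ∀ {g} → E ⊆ g → ∣ g ∩ e ∣ ≡ m → ∣ g ∩ A ∣ + d ≡ m
  E⊆g⇒∣g∩A∣+d≡m {g} E⊆g ∣g∩e∣≡m = begin
    ∣ g ∩ A ∣ + d         ≡⟨ cong (∣ g ∩ A ∣ +_) (trans (cong ∣_∣ (⊆⇒∩≡ E⊆g)) ∣E∣≡d) ⟨
    ∣ g ∩ A ∣ + ∣ g ∩ E ∣ ≡⟨ ∣g∩e∣≡∣g∩A∣+∣g∩E∣ g ⟨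
    ∣ g ∩ e ∣             ≡⟨ ∣g∩e∣≡m ⟩
    m                     ∎
    where open ≡-Reasoning

balanced-cover : ∀ {r t δ} {H : Hypergraph n} {e f} → 2 ≤ r → TightPair (r + (r + t)) ((r + t) + δ) H e f →
                 CoverNumberAtMost (r + (r + t)) H (∣ e ∣ C (r + (r + t)) ∸ (r + (r + t)))
balanced-cover {r = r} {t} {δ} {H} {e} {f} 2≤r P
  with E′ , E′⊆E , ∣E′∣≡r+t ← TightPair.subset-of-E P (m≤m+n (r + t) δ)
     | F′ , F′⊆F , ∣F′∣≡r+δ ← TightPair.subset-of-F P (+-monoˡ-≤ δ (m≤m+n r t))
  = cover-from-patch e-meets (⊆-trans E′⊆E (p─q⊆p e f)) 0<∣E′∣ ∣E′∣+r≡m ∣E′∣+l≡∣e∣ patch fits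
  where
  open TightPair P
  0<∣E′∣ : 0 < ∣ E′ ∣
  0<∣E′∣ = subst (0 <_) (sym ∣E′∣≡r+t) (≤-trans (≤-trans (s≤s z≤n) 2≤r) (m≤m+n r t))
  ∣E′∣+r≡m : ∣ E′ ∣ + r ≡ r + (r + t)
  ∣E′∣+r≡m = trans (cong (_+ r) ∣E′∣≡r+t) (+-comm (r + t) r)
  ∣E′∣+l≡∣e∣ : ∣ E′ ∣ + ((r + δ) + (r + t)) ≡ ∣ e ∣
  ∣E′∣+l≡∣e∣ = trans (cong (_+ _) ∣E′∣≡r+t) (trans (shuffle r t δ) (sym ∣e∣≡m+d))
    where
    shuffle : ∀ r t δ → (r + t) + ((r + δ) + (r + t)) ≡ (r + (r + t)) + ((r + t) + δ)
    shuffle = solve-∀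
  ∣F′∣+t≡∣F∣ : ∣ F′ ∣ + t ≡ ∣ F ∣
  ∣F′∣+t≡∣F∣ = trans (cong (_+ t) ∣F′∣≡r+δ) (trans (xy∙z≈xz∙y r δ t) (sym ∣F∣≡d))
  forced : ∀ {g} → g ∈ H → E′ ⊆ g → ∣ g ∩ e ∣ ≡ r + (r + t) → E′ ⊆ g × r ≤ ∣ g ∩ F′ ∣
  forced {g} g∈H E′⊆g ∣g∩e∣≡m = E′⊆g ,
    r+t≤∣g∩q∣⇒r≤∣g∩p∣ g F′⊆F ∣F′∣+t≡∣F∣ (subst (_≤ ∣ g ∩ F ∣) ∣E′∣≡r+t (∣D∣≤∣g∩F∣ E′⊆E g∈H E′⊆g ∣g∩e∣≡m))
  patch : Patch (r + (r + t)) H e E′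
  patch = extension-patch r (disjoint-mono E′⊆E F′⊆F E#F) ∣E′∣+r≡m forced
  fits : length (extensions r E′ F′) + (r + (r + t)) ≤ ((r + δ) + (r + t)) C r
  fits = subst (λ x → x + (r + (r + t)) ≤ _)
               (sym (trans (length-extensions r E′ F′) (cong (_C r) ∣F′∣≡r+δ))) (balanced-fits r t δ 2≤r)

lopsided-cover : ∀ {d r} {H : Hypergraph n} {e f} → 2 ≤ d → TightPair (d + d + r) d H e f →
                 CoverNumberAtMost (d + d + r) H (∣ e ∣ C (d + d + r) ∸ (d + d + r))
lopsided-cover {d = d} {r} {H} {e} {f} 2≤d P
  with A′ , A′⊆A , ∣A′∣≡d+r ← TightPair.subset-of-A P (subst (d + r ≤_) (sym (+-assoc d d r)) (m≤n+m (d + r) d))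
  = cover-from-patch e-meets (p─q⊆p e f) 0<∣E∣ ∣E∣+[d+r]≡m ∣E∣+m≡∣e∣ patch fits
  where
  open TightPair P
  0<∣E∣ : 0 < ∣ E ∣
  0<∣E∣ = subst (0 <_) (sym ∣E∣≡d) (≤-trans (s≤s z≤n) 2≤d)
  ∣E∣+[d+r]≡m : ∣ E ∣ + (d + r) ≡ d + d + r
  ∣E∣+[d+r]≡m = trans (cong (_+ (d + r)) ∣E∣≡d) (sym (+-assoc d d r))
  ∣E∣+m≡∣e∣ : ∣ E ∣ + (d + d + r) ≡ ∣ e ∣
  ∣E∣+m≡∣e∣ = trans (cong (_+ (d + d + r)) ∣E∣≡d) (trans (+-comm d (d + d + r)) (sym ∣e∣≡m+d))
  ∣E∪F∣+r≡m : ∣ E ∪ F ∣ + r ≡ d + d + r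
  ∣E∪F∣+r≡m = cong (_+ r) (trans (∣p∪q∣≡∣p∣+∣q∣ E#F) (cong₂ _+_ ∣E∣≡d ∣F∣≡d))
  ∣A′∣+d≡∣A∣ : ∣ A′ ∣ + d ≡ ∣ A ∣
  ∣A′∣+d≡∣A∣ = trans (cong (_+ d) ∣A′∣≡d+r) (trans (xy∙z≈xz∙y d r d) (sym ∣e∩f∣≡m))
  forced : ∀ {g} → g ∈ H → E ⊆ g → ∣ g ∩ e ∣ ≡ d + d + r → E ∪ F ⊆ g × r ≤ ∣ g ∩ A′ ∣
  forced {g} g∈H E⊆g ∣g∩e∣≡m =
    ∪-⊆ E⊆g (E⊆g⇒F⊆g g∈H E⊆g ∣g∩e∣≡m) , r+t≤∣g∩q∣⇒r≤∣g∩p∣ g A′⊆A ∣A′∣+d≡∣A∣ r+d≤∣g∩A∣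
    where
    shuffle : ∀ d r → r + d + d ≡ d + d + r
    shuffle = solve-∀
    r+d≤∣g∩A∣ : r + d ≤ ∣ g ∩ A ∣
    r+d≤∣g∩A∣ = ≤-reflexive (+-cancelʳ-≡ d _ _ (trans (shuffle d r) (sym (E⊆g⇒∣g∩A∣+d≡m E⊆g ∣g∩e∣≡m))))
  patch : Patch (d + d + r) H e E
  patch = extension-patch r (disjoint-mono ⊆-refl A′⊆A (∪-disjoint E#A F#A)) ∣E∪F∣+r≡m forced
  fits : length (extensions r (E ∪ F) A′) + (d + d + r) ≤ (d + d + r) C (d + r)
  fits = subst (λ x → x + (d + d + r) ≤ _)
               (sym (trans (length-extensions r (E ∪ F) A′) (cong (_C r) ∣A′∣≡d+r))) (lopsided-fits d r 2≤d)

m≡d≡3-cover : ∀ {H : Hypergraph n} {e f} → TightPair 3 3 H e f → CoverNumberAtMost 3 H (∣ e ∣ C 3 ∸ 3)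
m≡d≡3-cover {H = H} {e} {f} P with T , T⊆E , ∣T∣≡1 ← TightPair.subset-of-E P (s≤s z≤n)
  = cover-from-patch e-meets (⊆-trans T⊆E (p─q⊆p e f)) (subst (0 <_) (sym ∣T∣≡1) (s≤s z≤n))
                     (cong (_+ 2) ∣T∣≡1) (trans (cong (_+ 5) ∣T∣≡1) (sym ∣e∣≡m+d)) patch fits
  where
  open TightPair P
  triples : ∀ {q} → Disjoint T q → All (λ c → ∣ c ∣ ≡ 3) (extensions 2 T q)
  triples T#q = All.map (λ ∣c∣≡∣T∣+2 → trans ∣c∣≡∣T∣+2 (cong (_+ 2) ∣T∣≡1)) (extensions-size 2 T#q)
  covers′ : ∀ {g} → g ∈ H → T ⊆ g → ∣ g ∩ e ∣ ≡ 3 → Any (_⊆ g) (extensions 2 T A ++ extensions 2 T F)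
  covers′ {g} g∈H T⊆g ∣g∩e∣≡3 with 2 ≤? ∣ g ∩ A ∣
  ... | yes 2≤∣g∩A∣ = Any.++⁺ˡ (extensions-hit 2 T⊆g 2≤∣g∩A∣)
  ... | no 2≰∣g∩A∣  =
    Any.++⁺ʳ (extensions 2 T A) (extensions-hit 2 T⊆g (≤-trans 2≤∣g∩E∣ (∣g∩E∣≤∣g∩F∣ g∈H ∣g∩e∣≡3)))
    where
    2≤∣g∩E∣ : 2 ≤ ∣ g ∩ E ∣
    2≤∣g∩E∣ = +-cancelˡ-≤ 1 2 _ (≤-trans (≤-reflexive (trans (sym ∣g∩e∣≡3) (∣g∩e∣≡∣g∩A∣+∣g∩E∣ g)))
                                        (+-monoˡ-≤ ∣ g ∩ E ∣ (≤-pred (≰⇒> 2≰∣g∩A∣))))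
  patch : Patch 3 H e T
  patch = record
    { sets   = extensions 2 T A ++ extensions 2 T F
    ; sizes  = All.++⁺ (triples (disjoint-mono T⊆E ⊆-refl E#A)) (triples (disjoint-mono T⊆E ⊆-refl E#F))
    ; covers = covers′
    }
  fits : length (extensions 2 T A ++ extensions 2 T F) + 3 ≤ 5 C 2
  fits = begin
    length (extensions 2 T A ++ extensions 2 T F) + 3
      ≡⟨ cong (_+ 3) (length-++ (extensions 2 T A)) ⟩
    length (extensions 2 T A) + length (extensions 2 T F) + 3
      ≡⟨ cong₂ (λ a c → a + c + 3) (length-extensions 2 T A) (length-extensions 2 T F) ⟩
    ∣ A ∣ C 2 + ∣ F ∣ C 2 + 3
      ≡⟨ cong₂ (λ a c → a C 2 + c C 2 + 3) ∣e∩f∣≡m ∣F∣≡d ⟩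
    3 C 2 + 3 C 2 + 3
      ≤⟨ n≤1+n 9 ⟩
    5 C 2 ∎
    where open ≤-Reasoning

tight-pair-cover : ∀ {m d} {H : Hypergraph n} {e f} → Regime m d → TightPair m d H e f →
                   CoverNumberAtMost m H (∣ e ∣ C m ∸ m)
tight-pair-cover (balanced 2≤r) = balanced-cover 2≤r
tight-pair-cover (lopsided 2≤d) = lopsided-cover 2≤d
tight-pair-cover m≡d≡3          = m≡d≡3-cover

cover-without-tight-partner : ∀ {m} {H : Hypergraph n} {e} →
  (∀ {g} → g ∈ H → m ≤ ∣ g ∩ e ∣) → ¬ Any (λ f → ∣ e ∩ f ∣ ≡ m) H → 2 ≤ m → m < ∣ e ∣ →
  CoverNumberAtMost m H (∣ e ∣ C m ∸ m)
cover-without-tight-partner {m = suc m} {H} {e} e-meets no-partner (s≤s 1≤m) m<∣e∣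
  with D , D⊆e , ∣D∣≡1 ← subset-of-size 1 (≤-trans (s≤s z≤n) m<∣e∣)
  = cover-from-patch e-meets D⊆e (subst (0 <_) (sym ∣D∣≡1) (s≤s z≤n)) (cong (_+ m) ∣D∣≡1) ∣D∣+l≡∣e∣ patch fits
  where
  patch : Patch (suc m) H e D
  patch = record
    { sets   = []
    ; sizes  = []
    ; covers = λ {g} g∈H _ ∣g∩e∣≡m → ⊥-elim (no-partner (lose g∈H (trans (cong ∣_∣ (∩-comm e g)) ∣g∩e∣≡m)))
    }
  ∣D∣+l≡∣e∣ : ∣ D ∣ + (∣ e ∣ ∸ 1) ≡ ∣ e ∣
  ∣D∣+l≡∣e∣ = trans (cong (_+ (∣ e ∣ ∸ 1)) ∣D∣≡1) (m+[n∸m]≡n (≤-trans (s≤s z≤n) m<∣e∣))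
  1+m≤∣e∣∸1 : suc m ≤ ∣ e ∣ ∸ 1
  1+m≤∣e∣∸1 = m+n≤o⇒m≤o∸n (suc m) (subst (_≤ ∣ e ∣) (+-comm 1 (suc m)) m<∣e∣)
  fits : 0 + suc m ≤ (∣ e ∣ ∸ 1) C m
  fits = ≤-trans 1+m≤∣e∣∸1 (n≤nCk 1≤m 1+m≤∣e∣∸1)

intersecting : ∀ {k m} {H : Hypergraph n} → Uniform k H → m ≤ k → MatchingNumber m H 1 →
               ∀ {g h} → g ∈ H → h ∈ H → m ≤ ∣ g ∩ h ∣
intersecting {m = m} {H} uniform m≤k (_ , maximal) {g} {h} g∈H h∈H
  with ≡-dec _≟ᵇ_ g h | m ≤? ∣ g ∩ h ∣
... | _        | yes m≤∣g∩h∣ = m≤∣g∩h∣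
... | yes refl | no _        = subst (m ≤_) (sym (trans (cong ∣_∣ (∩-idem g)) (All.lookup uniform g∈H))) m≤k
... | no g≢h   | no m≰∣g∩h∣ = ⊥-elim (≤⇒≯ (maximal (g ∷ h ∷ []) pair) (s≤s ≤-refl))
  where
  pair : IsMMatching m H (g ∷ h ∷ [])
  pair = (g∈H ∷ h∈H ∷ []) , ((g≢h ∷ []) ∷ [] ∷ []) , ((≰⇒> m≰∣g∩h∣ ∷ []) ∷ [] ∷ [])

edge-of : ∀ {m} {H : Hypergraph n} → MatchingNumber m H 1 → ∃[ e ] e ∈ H
edge-of ((e ∷ [] , (e∈H ∷ [] , _) , _) , _) = e , e∈H

intersecting-cover : ∀ {m d} {H : Hypergraph n} {e} → e ∈ H → (∀ {g} → g ∈ H → ∣ g ∣ ≡ m + d) →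
  (∀ {g h} → g ∈ H → h ∈ H → m ≤ ∣ g ∩ h ∣) → 2 ≤ d → d ≤ m → 6 ≤ m + d →
  CoverNumberAtMost m H (∣ e ∣ C m ∸ m)
intersecting-cover {m = m} {d} {H} {e} e∈H size meets 2≤d d≤m 6≤m+d with any? (λ f → ∣ e ∩ f ∣ ≟ m) H
... | no ∄f = cover-without-tight-partner (λ g∈H → meets g∈H e∈H) ∄f (≤-trans 2≤d d≤m)
                (subst (m <_) (sym (size e∈H)) (m<m+n m (≤-trans (s≤s z≤n) 2≤d)))
... | yes ∃f with f , f∈H , ∣e∩f∣≡m ← find ∃f =
  tight-pair-cover (regime 2≤d d≤m 6≤m+d) (record
    { e-meets = λ g∈H → meets g∈H e∈H ; f-meets = λ g∈H → meets g∈H f∈H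
    ; ∣e∣≡m+d = size e∈H ; ∣f∣≡m+d = size f∈H ; ∣e∩f∣≡m = ∣e∩f∣≡m })

theorem3 : ∀ (k m : ℕ) → 6 ≤ k → k ≤ 2 * m → m ≤ k ∸ 2 →
    ∀ (n : ℕ) (H : Hypergraph n) → Uniform k H → MatchingNumber m H 1 →
    CoverNumberAtMost m H ((k C m) ∸ m)
theorem3 k m 6≤k k≤2m m≤k∸2 n H uniform ν≡1 with e , e∈H ← edge-of ν≡1 =
  subst (λ x → CoverNumberAtMost m H (x C m ∸ m)) (All.lookup uniform e∈H)
    (intersecting-cover e∈H size (intersecting uniform m≤k ν≡1) 2≤d d≤m (subst (6 ≤_) (sym m+d≡k) 6≤k))
  where
  m≤k : m ≤ k
  m≤k = ≤-trans m≤k∸2 (m∸n≤m k 2)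
  m+d≡k : m + (k ∸ m) ≡ k
  m+d≡k = m+[n∸m]≡n m≤k
  size : ∀ {g} → g ∈ H → ∣ g ∣ ≡ m + (k ∸ m)
  size g∈H = trans (All.lookup uniform g∈H) (sym m+d≡k)
  2≤d : 2 ≤ k ∸ m
  2≤d = m+n≤o⇒m≤o∸n 2 (subst (_≤ k) (+-comm m 2) (m≤o∸n⇒m+n≤o m (≤-trans (s≤s (s≤s z≤n)) 6≤k) m≤k∸2))
  d≤m : k ∸ m ≤ m
  d≤m = +-cancelˡ-≤ m _ _ (subst (_≤ m + m) (sym m+d≡k) (subst (k ≤_) (cong (m +_) (+-identityʳ m)) k≤2m))
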